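{- Every Ish-type arrangement is almost transitive.
   Context: A deformation of the braid arrangement in $\mathbb{R}^n$ is a finite set $\mathcal{A}$ of hyperplanes $x_i-x_j=s$ ($1\le i<j\le n$, $s\in\mathbb{Z}$), encoded by $\mathbf S=(S_{i,j})_{i<j}$, $S_{i,j}=\{s:(x_i-x_j=s)\in\mathcal{A}\}$, written $\mathcal{A}_{\mathbf S}$. For $i<j$: $S^-_{i,j}:=\{s\ge0:-s\in S_{i,j}\}$, $S^-_{j,i}:=\{0\}\cup\{s>0:s\in S_{i,j}\}$. $\mathcal{A}_{\mathbf S}$ is an Ish-type arrangement if $0\in S_{i,j}$ for all $1\le i<j\le n$ and $S_{i,j}=\{0\}$ whenever $i\neq1$. $\mathcal{A}_{\mathbf S}$ is almost transitive if for all distinct $i,j,k\in[n]$ with $1\notin\{i,k\}$ and all nonnegative integers $s\notin S^-_{i,j}$ and $t\notin S^-_{j,k}$, we have $s+t\notin S^-_{i,k}$. -}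

module Defs where

open import Data.Nat using (ℕ; zero; suc; _+_)
import Data.Nat as ℕ
open import Data.Integer using (ℤ; +_; -_)
open import Data.Fin using (Fin; _<_; toℕ)
open import Data.Fin.Properties using (<-cmp)
open import Data.List using (List)
open import Data.List.Membership.Propositional using (_∈_)
open import Data.Product using (_×_)
open import Data.Sum using (_⊎_)
open import Data.Empty using (⊥)
open import Relation.Binary.Definitions using (tri<; tri≈; tri>)
open import Relation.Binary.PropositionalEquality using (_≡_)
open import Relation.Nullary using (¬_)
open import Function.Bundles using (_⇔_)

-- A deformation of the braid arrangement in ℝ^n, encoded by 𝐒 = (S_{i,j})_{i<j}.
-- Coordinates are indexed by Fin n (coordinate 1 of the paper is Fin index 'zero').
-- S i j is the finite set (a list) of integers s with hyperplane x_i - x_j = s;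
-- only the values with i < j are meaningful (others are ignored).
Deformation : ℕ → Set
Deformation n = Fin n → Fin n → List ℤ

SMinus : ∀ {n} → Deformation n → Fin n → Fin n → ℕ → Set
SMinus S i j s with <-cmp i j
... | tri< _ _ _ = (- (+ s)) ∈ S i j
... | tri≈ _ _ _ = ⊥
... | tri> _ _ _ = (s ≡ 0) ⊎ ((0 ℕ.< s) × ((+ s) ∈ S j i))

IshType : ∀ {n} → Deformation n → Set
IshType {n} S =
  (∀ (i j : Fin n) → i < j → (+ 0) ∈ S i j) ×
  (∀ (i j : Fin n) → i < j → ¬ (toℕ i ≡ 0) → ∀ (s : ℤ) → (s ∈ S i j) ⇔ (s ≡ + 0))

AlmostTransitive : ∀ {n} → Deformation n → Set
AlmostTransitive {n} S =
  ∀ (i j k : Fin n) → ¬ (i ≡ j) → ¬ (j ≡ k) → ¬ (i ≡ k) →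
  ¬ (toℕ i ≡ 0) → ¬ (toℕ k ≡ 0) →
  ∀ (s t : ℕ) → ¬ SMinus S i j s → ¬ SMinus S j k t → ¬ SMinus S i k (s + t)

-- For i, k both different from 1, the Ish conditions force S_{i,k} = S_{k,i} = {0}, so
-- S⁻_{i,k} = {0}; hence s + t ∈ S⁻_{i,k} gives s = 0. But 0 ∈ S⁻_{i,j} for all i ≠ j.
module Submission where

open import Defs
open import Data.Nat using (ℕ; zero; suc)
open import Data.Nat.Properties using (m+n≡0⇒m≡0)
open import Data.Integer using (+_)
open import Data.Fin using (Fin; toℕ)
open import Data.Fin.Properties using (<-cmp)
open import Data.Product using (_,_; proj₁; proj₂)
open import Data.Sum using (inj₁; inj₂)
open import Relation.Nullary using (¬_)
open import Relation.Binary.Definitions using (tri<; tri≈; tri>)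
open import Relation.Binary.PropositionalEquality using (_≡_; refl)
open import Function.Bundles using (Equivalence)

module _ {n : ℕ} {S : Deformation n} (ish : IshType S) where

  zero∈SMinus : ∀ i j → ¬ i ≡ j → SMinus S i j 0
  zero∈SMinus i j i≢j with <-cmp i j
  ... | tri< i<j _ _ = proj₁ ish i j i<j
  ... | tri≈ _ i≡j _ = i≢j i≡j
  ... | tri> _ _ _   = inj₁ refl

  SMinus-nonFirst⇒≡0 : ∀ i k → ¬ toℕ i ≡ 0 → ¬ toℕ k ≡ 0 →
                       ∀ m → SMinus S i k m → m ≡ 0
  SMinus-nonFirst⇒≡0 i k i≢1 k≢1 m m∈S⁻ with <-cmp i k
  SMinus-nonFirst⇒≡0 i k i≢1 k≢1 zero    _     | tri< _ _ _ = refl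
  SMinus-nonFirst⇒≡0 i k i≢1 k≢1 (suc m) m∈S⁻ | tri< i<k _ _
    with Equivalence.to (proj₂ ish i k i<k i≢1 _) m∈S⁻
  ... | ()
  SMinus-nonFirst⇒≡0 i k i≢1 k≢1 m (inj₁ m≡0)        | tri> _ _ _ = m≡0
  SMinus-nonFirst⇒≡0 i k i≢1 k≢1 m (inj₂ (_ , m∈S)) | tri> _ _ k<i
    with Equivalence.to (proj₂ ish k i k<i k≢1 _) m∈S
  ... | refl = refl

lemma4p3 : ∀ (n : ℕ) (S : Deformation n) → IshType S → AlmostTransitive S
lemma4p3 n S ish i j k i≢j _ _ i≢1 k≢1 s t s∉S⁻ _ s+t∈S⁻ with
  m+n≡0⇒m≡0 s (SMinus-nonFirst⇒≡0 ish i k i≢1 k≢1 _ s+t∈S⁻)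
... | refl = s∉S⁻ (zero∈SMinus ish i j i≢j)
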